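{- Run the Uniform Budgeted Scheduler (UBS) described in the context. Let $(k,r)$ be a pair that UBS extracts and executes, with $T(k,r-1) < \tau_k$, and let $T_{\mathrm{UBS}}(k,r)$ be the total number of steps used by UBS (over all programs) after executing $(k,r)$. Then $$T_{\mathrm{UBS}}(k,r) \le T(k,r)\cdot \max\{j : T(j,1) \le T(k,r)\}.$$
   Context: UBS runs programs indexed by $k \in \{1,2,\ldots\}$. Program $k$ halts when it has executed exactly $\tau_k \in \{1,2,\ldots\}\cup\{\infty\}$ steps in total; running program $k$ with budget $b$ resumes it from where it stopped and executes it for $b$ further steps or until it halts, whichever comes first. Let $T:\{1,2,\ldots\}\times\{0,1,2,\ldots\}\to\{0,1,2,\ldots\}$ satisfy $T(k,r) < T(k,r+1)$, $T(k,r) \le T(k+1,r)$ and $T(k,0) = 0$ for all $k,r$. UBS maintains a priority queue of pairs $(k,r)$ ordered by $T(k,r)$ (ties broken arbitrarily), initially containing $(1,1)$. While the queue is nonempty: extract a pair $(k,r)$ of minimal $T(k,r)$; run program $k$ with budget $T(k,r)-T(k,r-1)$ (its $r$-th segment); if program $k$ has not halted, insert $(k,r+1)$; if $r=1$, insert $(k+1,1)$. -}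

module Defs where

open import Data.Nat using (ℕ; zero; suc; _+_; _*_; _∸_; _⊓_; _≤_; _<_; _≤ᵇ_; _≡ᵇ_)
open import Data.Unit using (⊤)
open import Data.Bool using (Bool; true; false; if_then_else_)
open import Data.Maybe using (Maybe; just; nothing)
open import Data.Product using (_×_; _,_; proj₁; proj₂; ∃)
open import Data.List using (List; []; _∷_; _++_)
open import Data.List.Relation.Unary.All using (All)
open import Relation.Binary.Construct.Closure.ReflexiveTransitive using (Star)

-- Programs are indexed by k ∈ {1,2,...} (elements of ℕ that are ≥ 1).
-- A halting time is an element of {1,2,...} ∪ {∞}: `just t` = t, `nothing` = ∞.
HaltTime : Set
HaltTime = Maybe ℕ

_<∞_ : ℕ → HaltTime → Set
x <∞ nothing = ⊤
x <∞ just t  = x < t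

-- Steps actually executed when a program with halting time τ, having already
-- executed p steps, is run with budget b.
executed : HaltTime → ℕ → ℕ → ℕ
executed nothing  p b = b
executed (just t) p b = b ⊓ (t ∸ p)

haltedAt : HaltTime → ℕ → Bool
haltedAt nothing  q = false
haltedAt (just t) q = t ≤ᵇ q

-- UBS state: the priority queue (as a list of pairs; order is irrelevant,
-- extraction picks any element of minimal priority), the number of steps
-- executed so far by each program, and the total number of steps used.
record State : Set where
  constructor mkState
  field
    queue    : List (ℕ × ℕ)
    progress : ℕ → ℕ
    total    : ℕ

open State public

initial : State
initial = mkState ((1 , 1) ∷ []) (λ _ → 0) 0

-- State after extracting (k,r) (queue minus that element = xs ++ ys),
-- running program k with budget T(k,r) - T(k,r-1), and inserting successors.
next : (ℕ → ℕ → ℕ) → (ℕ → HaltTime) →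
       List (ℕ × ℕ) → ℕ → ℕ → List (ℕ × ℕ) → (ℕ → ℕ) → ℕ → State
next T τ xs k r ys prog tot =
  mkState ((xs ++ ys)
             ++ (if haltedAt (τ k) (p + e) then [] else (k , suc r) ∷ [])
             ++ (if r ≡ᵇ 1 then (suc k , 1) ∷ [] else []))
          (λ j → if j ≡ᵇ k then p + e else prog j)
          (tot + e)
  where
    p = prog k
    e = executed (τ k) p (T k r ∸ T k (r ∸ 1))

data Step (T : ℕ → ℕ → ℕ) (τ : ℕ → HaltTime) : State → ℕ × ℕ → State → Set where
  step : ∀ xs k r ys prog tot →
         All (λ q → T k r ≤ T (proj₁ q) (proj₂ q)) (xs ++ ys) →
         Step T τ (mkState (xs ++ (k , r) ∷ ys) prog tot) (k , r)
                  (next T τ xs k r ys prog tot)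

Reachable : (ℕ → ℕ → ℕ) → (ℕ → HaltTime) → State → Set
Reachable T τ s = Star (λ s₁ s₂ → ∃ λ q → Step T τ s₁ q s₂) initial s

-- Every reachable state satisfies an invariant in terms of the number c of
-- programs started so far and the priority W of the last extracted pair: the
-- total equals the sum of the progress of programs 1..c, each progress is at
-- most W, and T(c,1) ≤ W. Extracted priorities never decrease, and each queued
-- pair (j,r) has progress j ≤ T(j,r-1), so running its segment leaves
-- progress j ≤ T(j,r); since every program occurs at most once in the queue,
-- running one program invalidates no other entry. After extracting (k,r) the
-- total is thus at most c·T(k,r), and T(c,1) ≤ T(k,r) forces c ≤ m.

module Submission where

open import Defs
open import Data.Nat using (ℕ; zero; suc; _+_; _*_; _∸_; _≤_; _<_; _≡ᵇ_; z≤n; s≤s; _≟_)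
open import Data.Nat.Properties
open import Data.Bool using (Bool; true; false; if_then_else_)
open import Data.Bool.Properties using (T-≡)
open import Data.Product using (_×_; _,_; proj₁; proj₂; ∃; ∃₂)
open import Data.Sum using (inj₁; inj₂)
open import Data.Maybe using (just; nothing)
open import Data.List using (List; []; _∷_; _++_)
open import Data.List.Relation.Unary.All as All using (All; []; _∷_)
import Data.List.Relation.Unary.All.Properties as All
open import Data.List.Relation.Unary.AllPairs using (AllPairs; []; _∷_)
import Data.List.Relation.Unary.AllPairs.Properties as AllPairs
open import Function using (_on_; _∘_)
open import Function.Bundles using (Equivalence)
open import Relation.Binary using (Rel; Symmetric)
open import Relation.Binary.PropositionalEquality
open import Relation.Binary.Construct.Closure.ReflexiveTransitive using (Star; ε; _◅_)
open import Relation.Nullary using (yes; no; contradiction)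

update : (ℕ → ℕ) → ℕ → ℕ → ℕ → ℕ
update f k v j = if j ≡ᵇ k then v else f j

update-same : ∀ f k v → update f k v k ≡ v
update-same f k v rewrite Equivalence.to T-≡ (≡⇒≡ᵇ k k refl) = refl

update-other : ∀ f {k v} j → j ≢ k → update f k v j ≡ f j
update-other f {k} j j≢k with j ≡ᵇ k in eq
... | false = refl
... | true  = contradiction (≡ᵇ⇒≡ j k (Equivalence.from T-≡ eq)) j≢k

sumTo : (ℕ → ℕ) → ℕ → ℕ
sumTo f zero    = 0
sumTo f (suc n) = sumTo f n + f (suc n)

sumTo-cong : ∀ {f g} n → (∀ j → j ≤ n → f j ≡ g j) → sumTo f n ≡ sumTo g n
sumTo-cong zero    f≗g = refl
sumTo-cong (suc n) f≗g =
  cong₂ _+_ (sumTo-cong n (λ j j≤n → f≗g j (m≤n⇒m≤1+n j≤n))) (f≗g (suc n) ≤-refl)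

sumTo-update : ∀ f {k} e n → 1 ≤ k → k ≤ n →
               sumTo (update f k (f k + e)) n ≡ sumTo f n + e
sumTo-update f e zero    (s≤s _) ()
sumTo-update f {k} e (suc n) 1≤k k≤1+n with k ≟ suc n
... | yes refl = begin
  sumTo g n + g (suc n)         ≡⟨ cong₂ _+_ (sumTo-cong n below) (update-same f (suc n) _) ⟩
  sumTo f n + (f (suc n) + e)   ≡⟨ +-assoc (sumTo f n) (f (suc n)) e ⟨
  sumTo f n + f (suc n) + e     ∎
  where
  open ≡-Reasoning
  g = update f (suc n) (f (suc n) + e)
  below : ∀ j → j ≤ n → g j ≡ f j
  below j j≤n = update-other f j (<⇒≢ (s≤s j≤n))
... | no k≢1+n = begin
  sumTo g n + g (suc n)         ≡⟨ cong₂ _+_ (sumTo-update f e n 1≤k (≤-pred (≤∧≢⇒< k≤1+n k≢1+n)))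
                                             (update-other f (suc n) (k≢1+n ∘ sym)) ⟩
  sumTo f n + e + f (suc n)     ≡⟨ +-assoc (sumTo f n) e (f (suc n)) ⟩
  sumTo f n + (e + f (suc n))   ≡⟨ cong (sumTo f n +_) (+-comm e (f (suc n))) ⟩
  sumTo f n + (f (suc n) + e)   ≡⟨ +-assoc (sumTo f n) (f (suc n)) e ⟨
  sumTo f n + f (suc n) + e     ∎
  where
  open ≡-Reasoning
  g = update f k (f k + e)

sumTo-vanishing : ∀ f {c} n → (∀ j → c < j → f j ≡ 0) → c ≤ n → sumTo f n ≡ sumTo f c
sumTo-vanishing f n vanish c≤n with m≤n⇒m<n∨m≡n c≤n
... | inj₂ refl = refl
sumTo-vanishing f {c} (suc n) vanish c≤n | inj₁ c<1+n = begin
  sumTo f n + f (suc n)   ≡⟨ cong₂ _+_ (sumTo-vanishing f n vanish (≤-pred c<1+n)) (vanish (suc n) c<1+n) ⟩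
  sumTo f c + 0           ≡⟨ +-identityʳ (sumTo f c) ⟩
  sumTo f c               ∎
  where open ≡-Reasoning

sumTo-≤ : ∀ {f W} n → (∀ j → f j ≤ W) → sumTo f n ≤ n * W
sumTo-≤ zero    f≤W = z≤n
sumTo-≤ {W = W} (suc n) f≤W =
  ≤-trans (+-mono-≤ (sumTo-≤ n f≤W) (f≤W (suc n))) (≤-reflexive (+-comm (n * W) W))

module _ {A : Set} where

  All-extract : ∀ {p} {P : A → Set p} xs {q ys} → All P (xs ++ q ∷ ys) → P q × All P (xs ++ ys)
  All-extract xs all with All.++⁻ xs all
  ... | Pxs , Pq ∷ Pys = Pq , All.++⁺ Pxs Pys

  AllPairs-extract : ∀ {ℓ} {R : Rel A ℓ} → Symmetric R → ∀ xs {q ys} →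
                     AllPairs R (xs ++ q ∷ ys) → All (R q) (xs ++ ys) × AllPairs R (xs ++ ys)
  AllPairs-extract R-sym []       (Rq ∷ pairs) = Rq , pairs
  AllPairs-extract R-sym (x ∷ xs) (Rx ∷ pairs) with AllPairs-extract R-sym xs pairs | All-extract xs Rx
  ... | Rq , pairs′ | Rxq , Rx′ = R-sym Rxq ∷ Rq , Rx′ ∷ pairs′

  All-unless : ∀ {P : A → Set} b {x} → P x → All P (if b then [] else x ∷ [])
  All-unless true  Px = []
  All-unless false Px = Px ∷ []

  AllPairs-unless : ∀ {ℓ} {R : Rel A ℓ} b {x} → AllPairs R (if b then [] else x ∷ [])
  AllPairs-unless true  = []
  AllPairs-unless false = [] ∷ []

executed-≤ : ∀ τ p b → executed τ p b ≤ b
executed-≤ nothing  p b = ≤-refl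
executed-≤ (just t) p b = m⊓n≤m b (t ∸ p)

Distinct : List (ℕ × ℕ) → Set
Distinct = AllPairs (_≢_ on proj₁)

data Slot (c : ℕ) : ℕ × ℕ → Set where
  fresh   : Slot c (suc c , 1)
  resumed : ∀ {j r} → 1 ≤ j → j ≤ c → Slot c (j , suc (suc r))

slot-positive : ∀ {c q} → Slot c q → 1 ≤ proj₁ q
slot-positive fresh            = s≤s z≤n
slot-positive (resumed 1≤j _) = 1≤j

slot-index≤ : ∀ {c q} → Slot c q → proj₁ q ≤ suc c
slot-index≤ fresh            = ≤-refl
slot-index≤ (resumed _ j≤c) = m≤n⇒m≤1+n j≤c

module Scheduler (T : ℕ → ℕ → ℕ) (τ : ℕ → HaltTime)
                 (T-increasing : ∀ k r → 1 ≤ k → T k r < T k (suc r))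
                 (T-monotone : ∀ k r → 1 ≤ k → T k r ≤ T (suc k) r)
                 (T-zero : ∀ k → 1 ≤ k → T k 0 ≡ 0) where

  record Pending (prog : ℕ → ℕ) (c W : ℕ) (q : ℕ × ℕ) : Set where
    constructor pending
    field
      slot      : Slot c q
      priority≥ : W ≤ T (proj₁ q) (proj₂ q)
      progress≤ : prog (proj₁ q) ≤ T (proj₁ q) (proj₂ q ∸ 1)

  record Invariant (s : State) (c W : ℕ) : Set where
    field
      total≡sum : total s ≡ sumTo (progress s) c
      progress≤ : ∀ j → progress s j ≤ W
      started≤  : 1 ≤ c → T c 1 ≤ W
      unstarted : ∀ j → c < j → progress s j ≡ 0
      queued    : All (Pending (progress s) c W) (queue s)
      distinct  : Distinct (queue s)

  initial-invariant : Invariant initial 0 0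
  initial-invariant = record
    { total≡sum = refl
    ; progress≤ = λ _ → z≤n
    ; started≤  = λ ()
    ; unstarted = λ _ _ → refl
    ; queued    = pending fresh z≤n z≤n ∷ []
    ; distinct  = [] ∷ []
    }

  module Extraction {xs k r ys prog tot c W}
    (inv : Invariant (mkState (xs ++ (k , suc r) ∷ ys) prog tot) c W)
    (minimal : All (λ q → T k (suc r) ≤ T (proj₁ q) (proj₂ q)) (xs ++ ys)) where

    open Invariant inv

    W′ : ℕ
    W′ = T k (suc r)

    e : ℕ
    e = executed (τ k) (prog k) (T k (suc r) ∸ T k r)

    prog′ : ℕ → ℕ
    prog′ = update prog k (prog k + e)

    extracted : Pending prog c W (k , suc r)
    extracted = proj₁ (All-extract xs queued)

    others : All (Pending prog c W) (xs ++ ys)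
    others = proj₂ (All-extract xs queued)

    others-distinct : All (λ q → k ≢ proj₁ q) (xs ++ ys) × Distinct (xs ++ ys)
    others-distinct = AllPairs-extract ≢-sym xs distinct

    1≤k : 1 ≤ k
    1≤k = slot-positive (Pending.slot extracted)

    W≤W′ : W ≤ W′
    W≤W′ = Pending.priority≥ extracted

    run≤ : prog k + e ≤ W′
    run≤ = ≤-trans (+-mono-≤ (Pending.progress≤ extracted) (executed-≤ (τ k) (prog k) _))
                   (≤-reflexive (m+[n∸m]≡n (<⇒≤ (T-increasing k r 1≤k))))

    progress′≤ : ∀ j → prog′ j ≤ W′
    progress′≤ j with j ≟ k
    ... | yes refl = subst (_≤ W′) (sym (update-same prog j _)) run≤
    ... | no j≢k   = subst (_≤ W′) (sym (update-other prog j j≢k)) (≤-trans (progress≤ j) W≤W′)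

    others′ : ∀ {c′} → (∀ {q} → Slot c q → k ≢ proj₁ q → Slot c′ q) →
              All (Pending prog′ c′ W′) (xs ++ ys)
    others′ lift = All.zipWith keep (All.zip (others , minimal) , proj₁ others-distinct)
      where
      keep : ∀ {q} → (Pending prog c W q × W′ ≤ T (proj₁ q) (proj₂ q)) × k ≢ proj₁ q →
             Pending prog′ _ W′ q
      keep ((pending sl _ pr , W′≤) , k≢j) =
        pending (lift sl k≢j) W′≤ (subst (_≤ _) (sym (update-other prog _ (≢-sym k≢j))) pr)

    continuation : ∀ {c′} → k ≤ c′ → (b : Bool) →
                   All (Pending prog′ c′ W′) (if b then [] else (k , suc (suc r)) ∷ [])
    continuation k≤c′ b = All-unless b
      (pending (resumed 1≤k k≤c′) (<⇒≤ (T-increasing k (suc r) 1≤k))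
               (subst (_≤ W′) (sym (update-same prog k _)) run≤))

    module _ {c′} (c≤c′ : c ≤ c′) (k≤c′ : k ≤ c′) where

      total′≡sum : tot + e ≡ sumTo prog′ c′
      total′≡sum = begin
        tot + e             ≡⟨ cong (_+ e) total≡sum ⟩
        sumTo prog c + e    ≡⟨ cong (_+ e) (sumTo-vanishing prog c′ unstarted c≤c′) ⟨
        sumTo prog c′ + e   ≡⟨ sumTo-update prog e c′ 1≤k k≤c′ ⟨
        sumTo prog′ c′      ∎
        where open ≡-Reasoning

      unstarted′ : ∀ j → c′ < j → prog′ j ≡ 0
      unstarted′ j c′<j = trans (update-other prog j (≢-sym (<⇒≢ (≤-<-trans k≤c′ c′<j))))
                                (unstarted j (≤-<-trans c≤c′ c′<j))

    distinct′ : ∀ {B} → Distinct B → All (λ q → k ≢ proj₁ q) B →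
                All (λ q → All (λ q′ → proj₁ q ≢ proj₁ q′) B) (xs ++ ys) → (b : Bool) →
                Distinct ((xs ++ ys) ++ (if b then [] else (k , suc (suc r)) ∷ []) ++ B)
    distinct′ B-distinct k∉B others∉B b =
      AllPairs.++⁺ (proj₂ others-distinct)
                   (AllPairs.++⁺ (AllPairs-unless b) B-distinct (All-unless b k∉B))
                   (All.zipWith (λ (k≢j , q∉B) → All.++⁺ (All-unless b (≢-sym k≢j)) q∉B)
                                (proj₁ others-distinct , others∉B))

  fresh-step : ∀ {xs ys prog tot c W} →
    Invariant (mkState (xs ++ (suc c , 1) ∷ ys) prog tot) c W →
    All (λ q → T (suc c) 1 ≤ T (proj₁ q) (proj₂ q)) (xs ++ ys) →
    Invariant (next T τ xs (suc c) 1 ys prog tot) (suc c) (T (suc c) 1)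
  fresh-step {c = c} inv minimal = record
    { total≡sum = total′≡sum (n≤1+n c) ≤-refl
    ; progress≤ = progress′≤
    ; started≤  = λ _ → ≤-refl
    ; unstarted = unstarted′ (n≤1+n c) ≤-refl
    ; queued    = All.++⁺ (others′ lift) (All.++⁺ (continuation ≤-refl _) (newcomer ∷ []))
    ; distinct  = distinct′ ([] ∷ []) (≢-sym 1+n≢n ∷ []) (All.map below-newcomer others) _
    }
    where
    open Extraction inv minimal
    lift : ∀ {q} → Slot c q → suc c ≢ proj₁ q → Slot (suc c) q
    lift fresh             1+c≢1+c = contradiction refl 1+c≢1+c
    lift (resumed 1≤j j≤c) _       = resumed 1≤j (m≤n⇒m≤1+n j≤c)
    newcomer : Pending prog′ (suc c) W′ (suc (suc c) , 1)
    newcomer = pending fresh (T-monotone (suc c) 1 1≤k)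
                       (≤-trans (≤-reflexive (unstarted′ (n≤1+n c) ≤-refl (suc (suc c)) ≤-refl)) z≤n)
    below-newcomer : ∀ {q} → Pending _ c _ q → All (λ q′ → proj₁ q ≢ proj₁ q′) ((suc (suc c) , 1) ∷ [])
    below-newcomer (pending sl _ _) = <⇒≢ (s≤s (slot-index≤ sl)) ∷ []

  resumed-step : ∀ {xs k r ys prog tot c W} →
    Invariant (mkState (xs ++ (k , suc (suc r)) ∷ ys) prog tot) c W →
    All (λ q → T k (suc (suc r)) ≤ T (proj₁ q) (proj₂ q)) (xs ++ ys) → k ≤ c →
    Invariant (next T τ xs k (suc (suc r)) ys prog tot) c (T k (suc (suc r)))
  resumed-step inv minimal k≤c = record
    { total≡sum = total′≡sum ≤-refl k≤c
    ; progress≤ = progress′≤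
    ; started≤  = λ 1≤c → ≤-trans (Invariant.started≤ inv 1≤c) W≤W′
    ; unstarted = unstarted′ ≤-refl k≤c
    ; queued    = All.++⁺ (others′ (λ sl _ → sl)) (All.++⁺ (continuation k≤c _) [])
    ; distinct  = distinct′ [] [] (All.map (λ _ → []) others) _
    }
    where open Extraction inv minimal

  step-invariant : ∀ {s s′ k r c W} → Invariant s c W → Step T τ s (k , r) s′ →
                   ∃ λ c′ → Invariant s′ c′ (T k r)
  step-invariant inv (step xs k r ys prog tot minimal) with All-extract xs (Invariant.queued inv)
  ... | pending fresh _ _ , _             = _ , fresh-step inv minimal
  ... | pending (resumed _ k≤c) _ _ , _ = _ , resumed-step inv minimal k≤c

  reachable-invariant : ∀ {s} → Reachable T τ s → ∃₂ (Invariant s)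
  reachable-invariant = go (0 , 0 , initial-invariant)
    where
    go : ∀ {s₁ s₂} → ∃₂ (Invariant s₁) → Star (λ s s′ → ∃ λ q → Step T τ s q s′) s₁ s₂ →
         ∃₂ (Invariant s₂)
    go inv ε = inv
    go (_ , _ , inv) ((_ , st) ◅ steps) = go (_ , _ , proj₂ (step-invariant inv st)) steps

corollary1 : (T : ℕ → ℕ → ℕ) (τ : ℕ → HaltTime) →
    (∀ k → 1 ≤ k → τ k ≢ just 0) →
    (∀ k r → 1 ≤ k → T k r < T k (suc r)) →
    (∀ k r → 1 ≤ k → T k r ≤ T (suc k) r) →
    (∀ k → 1 ≤ k → T k 0 ≡ 0) →
    ∀ k r (s s′ : State) → Reachable T τ s → Step T τ s (k , r) s′ →
    T k (r ∸ 1) <∞ τ k →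
    ∀ m → (∀ j → 1 ≤ j → T j 1 ≤ T k r → j ≤ m) →
    total s′ ≤ T k r * m
corollary1 T τ _ T-increasing T-monotone T-zero k r s s′ reachable st _ m maximal = begin
  total s′                    ≡⟨ total≡sum ⟩
  sumTo (progress s′) c′      ≤⟨ sumTo-≤ c′ progress≤ ⟩
  c′ * T k r                  ≤⟨ *-monoˡ-≤ (T k r) (started≤m c′ started≤) ⟩
  m * T k r                   ≡⟨ *-comm m (T k r) ⟩
  T k r * m                   ∎
  where
  open Scheduler T τ T-increasing T-monotone T-zero
  open ≤-Reasoning
  after : ∃ λ c′ → Invariant s′ c′ (T k r)
  after = step-invariant (proj₂ (proj₂ (reachable-invariant reachable))) st
  c′ = proj₁ after
  open Invariant (proj₂ after)
  started≤m : ∀ n → (1 ≤ n → T n 1 ≤ T k r) → n ≤ m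
  started≤m zero    _        = z≤n
  started≤m (suc n) started≤ = maximal (suc n) (s≤s z≤n) (started≤ (s≤s z≤n))
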